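{- For every $n\geq 2$, $\kappa(BH_n;K_{1,3})\leq n$ and $\kappa^s(BH_n;K_{1,3})\leq n$.
   Context: The $n$-dimensional balanced hypercube $BH_n$ is the graph with vertex set $\{0,1,2,3\}^n$, vertices written $(a_0,a_1,\dots,a_{n-1})$, in which $(a_0,\dots,a_{n-1})$ is adjacent exactly to the $2n$ vertices $((a_0\pm 1)\bmod 4,a_1,\dots,a_{n-1})$ and, for each $1\le i\le n-1$, $((a_0\pm1)\bmod 4,a_1,\dots,a_{i-1},(a_i+(-1)^{a_0})\bmod 4,a_{i+1},\dots,a_{n-1})$. For a connected graph $G$ and a set $F$ of connected subgraphs of $G$, let $V(F)$ be the union of their vertex sets; $F$ is a subgraph-cut if $G-V(F)$ is disconnected or trivial. For a connected subgraph $H$ of $G$, an $H$-structure-cut is a subgraph-cut each of whose elements is isomorphic to $H$, and $\kappa(G;H)$ is the minimum cardinality of an $H$-structure-cut; an $H$-substructure-cut is a subgraph-cut each of whose elements is isomorphic to a connected subgraph of $H$, and $\kappa^s(G;H)$ is the minimum cardinality of an $H$-substructure-cut. $K_{1,3}$ is the star with three leaves. -}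

module Defs where

open import Level using (Level; 0ℓ) renaming (suc to lsuc)
open import Data.Nat using (ℕ; zero; suc; _≤_)
open import Data.Fin using (Fin; zero; suc)
open import Data.Vec using (Vec; _∷_; updateAt)
open import Data.List using (List; length)
open import Data.List.Relation.Unary.Any using (Any)
open import Data.Product using (Σ; ∃; _×_; _,_)
open import Data.Sum using (_⊎_)
open import Relation.Nullary using (¬_)
open import Relation.Binary.PropositionalEquality using (_≡_; _≢_)

record Graph : Set₁ where
  field
    Vtx : Set
    Adj : Vtx → Vtx → Set
open Graph public

inc4 : Fin 4 → Fin 4
inc4 zero = suc zero
inc4 (suc zero) = suc (suc zero)
inc4 (suc (suc zero)) = suc (suc (suc zero))
inc4 (suc (suc (suc zero))) = zero

dec4 : Fin 4 → Fin 4
dec4 zero = suc (suc (suc zero))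
dec4 (suc zero) = zero
dec4 (suc (suc zero)) = suc zero
dec4 (suc (suc (suc zero))) = suc (suc zero)

-- x ↦ x + (-1)^{a0} mod 4
shift : Fin 4 → Fin 4 → Fin 4
shift zero = inc4
shift (suc zero) = dec4
shift (suc (suc zero)) = inc4
shift (suc (suc (suc zero))) = dec4

PlusMinus1 : Fin 4 → Fin 4 → Set
PlusMinus1 a b = (b ≡ inc4 a) ⊎ (b ≡ dec4 a)

-- A vertex a_0 ∷ as (as = (a_1,…,a_{n-1})) is adjacent
-- to ((a_0 ± 1), as) and, for each i ∈ {1,…,n-1} (index i-1 of the tail),
-- to ((a_0 ± 1), a_1, …, a_i + (-1)^{a_0}, …, a_{n-1}).
data BHAdj : {n : ℕ} → Vec (Fin 4) n → Vec (Fin 4) n → Set where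
  inner : {m : ℕ} {a0 b0 : Fin 4} {as : Vec (Fin 4) m} →
          PlusMinus1 a0 b0 → BHAdj (a0 ∷ as) (b0 ∷ as)
  outer : {m : ℕ} {a0 b0 : Fin 4} {as : Vec (Fin 4) m} (i : Fin m) →
          PlusMinus1 a0 b0 → BHAdj (a0 ∷ as) (b0 ∷ updateAt as i (shift a0))

BH : ℕ → Graph
BH n = record { Vtx = Vec (Fin 4) n ; Adj = BHAdj }

K13Adj : Fin 4 → Fin 4 → Set
K13Adj u v = (u ≡ zero × v ≢ zero) ⊎ (v ≡ zero × u ≢ zero)

K13 : Graph
K13 = record { Vtx = Fin 4 ; Adj = K13Adj }

-- Embeddings: an injective homomorphism H → G; its image (vertices φ(V(H)),
-- edges φ(E(H))) is exactly a subgraph of G isomorphic to H.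

record Embedding (H G : Graph) : Set where
  field
    map       : Vtx H → Vtx G
    injective : ∀ u v → map u ≡ map v → u ≡ v
    hom       : ∀ u v → Adj H u v → Adj G (map u) (map v)
open Embedding public

InImage : {H G : Graph} → Embedding H G → Vtx G → Set
InImage {H} e v = Σ (Vtx H) (λ u → map e u ≡ v)

-- Walk G X u v : a walk from u to v in G all of whose vertices after
-- the first avoid X.
data Walk {ℓ : Level} (G : Graph) (X : Vtx G → Set ℓ) : Vtx G → Vtx G → Set ℓ where
  here : {u : Vtx G} → Walk G X u u
  step : {u w v : Vtx G} → Adj G u w → ¬ X w → Walk G X w v → Walk G X u v

Connected : Graph → Set
Connected G = Vtx G × (∀ u v → Walk G (λ _ → Data.Empty.⊥) u v)
  where import Data.Empty

DisconnectedOrTrivialWithout : {ℓ : Level} (G : Graph) → (Vtx G → Set ℓ) → Set ℓ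
DisconnectedOrTrivialWithout G X =
  (Σ (Vtx G) λ u → Σ (Vtx G) λ v → ¬ X u × ¬ X v × ¬ Walk G X u v)
  ⊎ (Σ (Vtx G) λ u → ¬ X u × (∀ v → ¬ X v → v ≡ u))

VStruct : {H G : Graph} → List (Embedding H G) → Vtx G → Set
VStruct F v = Any (λ e → InImage e v) F

IsStructureCut : (G H : Graph) → List (Embedding H G) → Set
IsStructureCut G H F = DisconnectedOrTrivialWithout G (VStruct F)

-- a subgraph of G isomorphic to a connected subgraph of H:
-- a connected graph H' together with an embedding of H' into H (so H' is
-- isomorphic to a subgraph of H) and an embedding of H' into G.
record SubPiece (H G : Graph) : Set₁ where
  field
    shape     : Graph
    connected : Connected shape
    intoH     : Embedding shape H
    intoG     : Embedding shape G
open SubPiece public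

VSub : {H G : Graph} → List (SubPiece H G) → Vtx G → Set₁
VSub F v = Any (λ p → InImage (intoG p) v) F

IsSubstructureCut : (G H : Graph) → List (SubPiece H G) → Set₁
IsSubstructureCut G H F = DisconnectedOrTrivialWithout G (VSub F)

κ≤ : Graph → Graph → ℕ → Set
κ≤ G H k = Σ (List (Embedding H G)) λ F → length F ≤ k × IsStructureCut G H F

κˢ≤ : Graph → Graph → ℕ → Set₁
κˢ≤ G H k = Σ (List (SubPiece H G)) λ F → length F ≤ k × IsSubstructureCut G H F

module Submission where

-- Write n = m + 2 and x ∈ {0,1,2,3}^{n-1} for a tail of a
-- vertex of BH_n.  Since (-1)^0 = (-1)^2, the vertices (0,x) and (2,x) have the
-- same neighbourhood: the 2n vertices (1,y), (3,y) with y = x or y = x + e_i.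
-- Pairing these neighbours as leaves of n stars K_{1,3} centred at (2,x) covers
-- the whole neighbourhood of (0,x) while touching no vertex with first
-- coordinate 0; so deleting the stars separates (0,x) from (0, x + e_0).

open import Defs
open import Data.Nat using (ℕ; suc; _≤_; s≤s)
open import Data.Nat.Properties using (≤-reflexive)
open import Data.Product using (_×_; _,_)
open import Data.Sum using (inj₁; inj₂)
open import Data.Empty using (⊥)
open import Data.Fin using (Fin; zero; suc)
open import Data.Vec using (Vec; _∷_; updateAt; replicate; lookup)
open import Data.Vec.Properties
  using (∷-injectiveˡ; ∷-injectiveʳ; updateAt-updateAt; updateAt-id-local; lookup∘updateAt)
open import Data.List using (List; _∷_; length; tabulate)
import Data.List as List
open import Data.List.Properties using (length-tabulate; length-map)
open import Data.List.Relation.Unary.Any using (here; there)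
import Data.List.Relation.Unary.Any.Properties as Any
open import Relation.Nullary using (¬_)
open import Relation.Binary.PropositionalEquality
  using (_≡_; _≢_; refl; cong; sym; trans; subst)

module _ {G : Graph} where

  walk-weaken : ∀ {ℓ ℓ′} {X : Vtx G → Set ℓ} {Y : Vtx G → Set ℓ′} →
                (∀ v → X v → Y v) → ∀ {u v} → Walk G Y u v → Walk G X u v
  walk-weaken X⊆Y here             = here
  walk-weaken X⊆Y (step a w∉Y rest) =
    step a (λ w∈X → w∉Y (X⊆Y _ w∈X)) (walk-weaken X⊆Y rest)

  cut-cong : ∀ {ℓ ℓ′} {X : Vtx G → Set ℓ} {Y : Vtx G → Set ℓ′} →
             (∀ v → X v → Y v) → (∀ v → Y v → X v) →
             DisconnectedOrTrivialWithout G X → DisconnectedOrTrivialWithout G Y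
  cut-cong X⊆Y Y⊆X (inj₁ (u , v , u∉X , v∉X , noWalk)) =
    inj₁ (u , v , (λ u∈Y → u∉X (Y⊆X _ u∈Y)) , (λ v∈Y → v∉X (Y⊆X _ v∈Y)) ,
          λ w → noWalk (walk-weaken X⊆Y w))
  cut-cong X⊆Y Y⊆X (inj₂ (u , u∉X , unique)) =
    inj₂ (u , (λ u∈Y → u∉X (Y⊆X _ u∈Y)) , λ v v∉Y → unique v (λ v∈X → v∉Y (X⊆Y _ v∈X)))

  isolating-cut : ∀ {ℓ} {X : Vtx G → Set ℓ} {u v : Vtx G} →
                  ¬ X u → ¬ X v → u ≢ v → (∀ w → Adj G u w → X w) →
                  DisconnectedOrTrivialWithout G X
  isolating-cut {u = u} {v} u∉X v∉X u≢v N[u]⊆X = inj₁ (u , v , u∉X , v∉X , noWalk)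
    where
    noWalk : ¬ Walk G _ u v
    noWalk here           = u≢v refl
    noWalk (step a w∉X _) = w∉X (N[u]⊆X _ a)

  star : (∀ {u v} → Adj G u v → Adj G v u) → (∀ {u v} → Adj G u v → u ≢ v) →
         {c l₁ l₂ l₃ : Vtx G} → Adj G c l₁ → Adj G c l₂ → Adj G c l₃ →
         l₁ ≢ l₂ → l₁ ≢ l₃ → l₂ ≢ l₃ → Embedding K13 G
  star sym-adj loopless {c} {l₁} {l₂} {l₃} c~l₁ c~l₂ c~l₃ l₁≢l₂ l₁≢l₃ l₂≢l₃ =
    record { map = vertex ; injective = injective′ ; hom = hom′ }
    where
    vertex : Fin 4 → Vtx G
    vertex zero                   = c
    vertex (suc zero)             = l₁
    vertex (suc (suc zero))       = l₂
    vertex (suc (suc (suc zero))) = l₃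

    centre~leaf : ∀ j → Adj G c (vertex (suc j))
    centre~leaf zero             = c~l₁
    centre~leaf (suc zero)       = c~l₂
    centre~leaf (suc (suc zero)) = c~l₃

    distinct-leaves : ∀ i j → vertex (suc i) ≡ vertex (suc j) → suc i ≡ suc j
    distinct-leaves zero             zero             _ = refl
    distinct-leaves zero             (suc zero)       e with () ← l₁≢l₂ e
    distinct-leaves zero             (suc (suc zero)) e with () ← l₁≢l₃ e
    distinct-leaves (suc zero)       zero             e with () ← l₁≢l₂ (sym e)
    distinct-leaves (suc zero)       (suc zero)       _ = refl
    distinct-leaves (suc zero)       (suc (suc zero)) e with () ← l₂≢l₃ e
    distinct-leaves (suc (suc zero)) zero             e with () ← l₁≢l₃ (sym e)
    distinct-leaves (suc (suc zero)) (suc zero)       e with () ← l₂≢l₃ (sym e)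
    distinct-leaves (suc (suc zero)) (suc (suc zero)) _ = refl

    injective′ : ∀ i j → vertex i ≡ vertex j → i ≡ j
    injective′ zero    zero    _ = refl
    injective′ zero    (suc j) e with () ← loopless (centre~leaf j) e
    injective′ (suc i) zero    e with () ← loopless (centre~leaf i) (sym e)
    injective′ (suc i) (suc j) e = distinct-leaves i j e

    hom′ : ∀ i j → K13Adj i j → Adj G (vertex i) (vertex j)
    hom′ zero    zero    (inj₁ (_ , 0≢0)) with () ← 0≢0 refl
    hom′ zero    zero    (inj₂ (_ , 0≢0)) with () ← 0≢0 refl
    hom′ zero    (suc j) _                = centre~leaf j
    hom′ (suc i) zero    _                = sym-adj (centre~leaf i)
    hom′ (suc i) (suc j) (inj₁ (() , _))
    hom′ (suc i) (suc j) (inj₂ (() , _))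

-- For connected H, every H-structure-cut is an H-substructure-cut: regard
-- each copy of H as the connected subgraph H of H itself.
κˢ≤κ : {G H : Graph} → Connected H → ∀ {k} → κ≤ G H k → κˢ≤ G H k
κˢ≤κ {G} {H} H-connected (F , |F|≤k , F-cut) =
  List.map asPiece F ,
  subst (_≤ _) (sym (length-map asPiece F)) |F|≤k ,
  cut-cong (λ _ → Any.map⁺) (λ _ → Any.map⁻) F-cut
  where
  identity : Embedding H H
  identity = record { map = λ u → u ; injective = λ _ _ e → e ; hom = λ _ _ a → a }

  asPiece : Embedding H G → SubPiece H G
  asPiece e = record { shape = H ; connected = H-connected ; intoH = identity ; intoG = e }

K13-connected : Connected K13
K13-connected = zero , walk
  where
  leaf→centre : ∀ j → K13Adj (suc j) zero
  leaf→centre j = inj₂ (refl , λ ())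

  centre→ : ∀ v → Walk K13 (λ _ → ⊥) zero v
  centre→ zero    = here
  centre→ (suc j) = step (inj₁ (refl , λ ())) (λ ()) here

  walk : ∀ u v → Walk K13 (λ _ → ⊥) u v
  walk zero    v = centre→ v
  walk (suc j) v = step (leaf→centre j) (λ ()) (centre→ v)

inc4-no-fixpoint : ∀ a → inc4 a ≢ a
inc4-no-fixpoint zero                   ()
inc4-no-fixpoint (suc zero)             ()
inc4-no-fixpoint (suc (suc zero))       ()
inc4-no-fixpoint (suc (suc (suc zero))) ()

dec4∘inc4 : ∀ a → dec4 (inc4 a) ≡ a
dec4∘inc4 zero                   = refl
dec4∘inc4 (suc zero)             = refl
dec4∘inc4 (suc (suc zero))       = refl
dec4∘inc4 (suc (suc (suc zero))) = refl

inc4∘dec4 : ∀ a → inc4 (dec4 a) ≡ a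
inc4∘dec4 zero                   = refl
inc4∘dec4 (suc zero)             = refl
inc4∘dec4 (suc (suc zero))       = refl
inc4∘dec4 (suc (suc (suc zero))) = refl

±1-sym : ∀ {a b} → PlusMinus1 a b → PlusMinus1 b a
±1-sym {a} (inj₁ refl) = inj₂ (sym (dec4∘inc4 a))
±1-sym {a} (inj₂ refl) = inj₁ (sym (inc4∘dec4 a))

±1-irrefl : ∀ {a} → ¬ PlusMinus1 a a
±1-irrefl {a} (inj₁ a≡a+1) = inc4-no-fixpoint a (sym a≡a+1)
±1-irrefl {a} (inj₂ a≡a-1) =
  inc4-no-fixpoint a (trans (cong inc4 a≡a-1) (inc4∘dec4 a))

-- Adjacent first coordinates have opposite parity, so their shifts
-- x ↦ x + (-1)^a and x ↦ x + (-1)^b undo each other.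
shift-inverse : ∀ {a b} → PlusMinus1 a b → ∀ x → shift b (shift a x) ≡ x
shift-inverse {zero}                 (inj₁ refl) = dec4∘inc4
shift-inverse {zero}                 (inj₂ refl) = dec4∘inc4
shift-inverse {suc zero}             (inj₁ refl) = inc4∘dec4
shift-inverse {suc zero}             (inj₂ refl) = inc4∘dec4
shift-inverse {suc (suc zero)}       (inj₁ refl) = dec4∘inc4
shift-inverse {suc (suc zero)}       (inj₂ refl) = dec4∘inc4
shift-inverse {suc (suc (suc zero))} (inj₁ refl) = inc4∘dec4
shift-inverse {suc (suc (suc zero))} (inj₂ refl) = inc4∘dec4

bump : ∀ {k} → Vec (Fin 4) k → Fin k → Vec (Fin 4) k
bump x i = updateAt x i inc4

bump-≢ : ∀ {k} (x : Vec (Fin 4) k) i → bump x i ≢ x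
bump-≢ x i e = inc4-no-fixpoint (lookup x i)
  (trans (sym (lookup∘updateAt i x)) (cong (λ y → lookup y i) e))

-- BH_n is a simple graph: its adjacency is symmetric (reversing an outer
-- edge undoes the shift, by shift-inverse) ...
BH-sym : ∀ {n} {u v : Vec (Fin 4) n} → BHAdj u v → BHAdj v u
BH-sym (inner p) = inner (±1-sym p)
BH-sym {u = a ∷ x} (outer {b0 = b} i p) =
  subst (λ y → BHAdj (b ∷ updateAt x i (shift a)) (a ∷ y)) undo (outer i (±1-sym p))
  where
  undo : updateAt (updateAt x i (shift a)) i (shift b) ≡ x
  undo = trans (updateAt-updateAt i x) (updateAt-id-local i x (shift-inverse p _))

-- ... and loopless (every edge changes the first coordinate).
BH-loopless : ∀ {n} {u v : Vec (Fin 4) n} → BHAdj u v → u ≢ v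
BH-loopless (inner p)   e = ±1-irrefl (subst (PlusMinus1 _) (sym (∷-injectiveˡ e)) p)
BH-loopless (outer i p) e = ±1-irrefl (subst (PlusMinus1 _) (sym (∷-injectiveˡ e)) p)

-- (0,x) and (2,x) are twins: since (-1)^0 = (-1)^2, every neighbour of
-- (0,x) is also a neighbour of (2,x).
twin : ∀ {k} {x : Vec (Fin 4) k} {w} →
       BHAdj (zero ∷ x) w → BHAdj (suc (suc zero) ∷ x) w
twin (inner (inj₁ refl))   = inner (inj₂ refl)
twin (inner (inj₂ refl))   = inner (inj₁ refl)
twin (outer i (inj₁ refl)) = outer i (inj₂ refl)
twin (outer i (inj₂ refl)) = outer i (inj₁ refl)

module Isolation {m : ℕ} (x : Vec (Fin 4) (suc m)) where

  BHn : Graph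
  BHn = BH (suc (suc m))

  x≢x+e₀ : x ≢ bump x zero
  x≢x+e₀ e = bump-≢ x zero (sym e)

  to1 : BHAdj (zero ∷ x) (suc zero ∷ x)
  to1 = inner (inj₁ refl)

  to3 : BHAdj (zero ∷ x) (suc (suc (suc zero)) ∷ x)
  to3 = inner (inj₂ refl)

  to1↑ : ∀ i → BHAdj (zero ∷ x) (suc zero ∷ bump x i)
  to1↑ i = outer i (inj₁ refl)

  to3↑ : ∀ i → BHAdj (zero ∷ x) (suc (suc (suc zero)) ∷ bump x i)
  to3↑ i = outer i (inj₂ refl)

  star-at-twin : ∀ {y z} → BHAdj (zero ∷ x) (suc zero ∷ y) →
                 BHAdj (zero ∷ x) (suc (suc (suc zero)) ∷ y) →
                 BHAdj (zero ∷ x) (suc zero ∷ z) → y ≢ z → Embedding K13 BHn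
  star-at-twin a₁ a₃ a₁′ y≢z =
    star BH-sym BH-loopless (twin a₁) (twin a₃) (twin a₁′)
      (λ ()) (λ e → y≢z (∷-injectiveʳ e)) (λ ())

  star-at-twin-avoids-0 : ∀ {y z} a₁ a₃ a₁′ (y≢z : y ≢ z) w →
                          ¬ InImage (star-at-twin a₁ a₃ a₁′ y≢z) (zero ∷ w)
  star-at-twin-avoids-0 _ _ _ _ _ (zero , ())
  star-at-twin-avoids-0 _ _ _ _ _ (suc zero , ())
  star-at-twin-avoids-0 _ _ _ _ _ (suc (suc zero) , ())
  star-at-twin-avoids-0 _ _ _ _ _ (suc (suc (suc zero)) , ())

  star₀ : Embedding K13 BHn
  star₀ = star-at-twin to1 to3 (to1↑ zero) x≢x+e₀

  starᵢ : Fin (suc m) → Embedding K13 BHn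
  starᵢ i = star-at-twin (to1↑ i) (to3↑ i) to1 (bump-≢ x i)

  stars : List (Embedding K13 BHn)
  stars = star₀ ∷ tabulate starᵢ

  stars-length : length stars ≡ suc (suc m)
  stars-length = cong suc (length-tabulate starᵢ)

  neighbourhood-covered : ∀ w → BHAdj (zero ∷ x) w → VStruct stars w
  neighbourhood-covered _ (inner (inj₁ refl))   = here (suc zero , refl)
  neighbourhood-covered _ (inner (inj₂ refl))   = here (suc (suc zero) , refl)
  neighbourhood-covered _ (outer i (inj₁ refl)) = there (Any.tabulate⁺ {f = starᵢ} i (suc zero , refl))
  neighbourhood-covered _ (outer i (inj₂ refl)) = there (Any.tabulate⁺ {f = starᵢ} i (suc (suc zero) , refl))

  stars-avoid-0 : ∀ w → ¬ VStruct stars (zero ∷ w)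
  stars-avoid-0 w (here p) = star-at-twin-avoids-0 to1 to3 (to1↑ zero) x≢x+e₀ w p
  stars-avoid-0 w (there p) with i , q ← Any.tabulate⁻ {f = starᵢ} p =
    star-at-twin-avoids-0 (to1↑ i) (to3↑ i) to1 (bump-≢ x i) w q

  stars-cut : IsStructureCut BHn K13 stars
  stars-cut = isolating-cut (stars-avoid-0 x) (stars-avoid-0 (bump x zero))
    (λ e → x≢x+e₀ (∷-injectiveʳ e)) neighbourhood-covered

lemma13 : (n : ℕ) → 2 ≤ n → κ≤ (BH n) K13 n × κˢ≤ (BH n) K13 n
lemma13 (suc (suc m)) (s≤s (s≤s _)) = κ-bound , κˢ≤κ K13-connected κ-bound
  where
  open Isolation {m} (replicate (suc m) zero)

  κ-bound : κ≤ (BH (suc (suc m))) K13 (suc (suc m))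
  κ-bound = stars , ≤-reflexive stars-length , stars-cut
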